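{- For integers $k\geq 2$ and $n\geq 1$, let $r_k(n)$ denote the maximum size of a set $R\subseteq\{0,1,\dots,n-1\}$ such that for all distinct $r,r'\in R$, $r-r'$ is not congruent modulo $n$ to $x^k$ for any $x\in\mathbb{Z}$. Then: (i) for every square-free positive integer $m$ and every $k\geq 2$, $r_k(m^k)\geq m^{k-1}r_k(m)$; (ii) for every prime $p$ and every $k\geq 2$ with $p\nmid k$, $r_k(p^k)=p^{k-1}r_k(p)$. -}

module Defs where

open import Data.Nat as ℕ using (ℕ; _≤_; _*_)
open import Data.Nat.Divisibility using (_∣_)
open import Data.Integer as ℤ using (ℤ; +_)
open import Data.Integer.Divisibility using () renaming (_∣_ to _∣ℤ_)
open import Data.Fin using (Fin; toℕ)
open import Data.Fin.Subset using (Subset; _∈_; ∣_∣)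
open import Data.Product using (Σ; ∃; _×_)
open import Relation.Binary.PropositionalEquality using (_≡_)
open import Relation.Nullary using (¬_)

_≡_[mod_] : ℤ → ℤ → ℕ → Set
a ≡ b [mod n ] = (+ n) ∣ℤ (a ℤ.- b)

IsPowerMod : ℕ → ℕ → ℤ → Set
IsPowerMod k n d = ∃ λ (x : ℤ) → d ≡ x ℤ.^ k [mod n ]

Admissible : ℕ → (n : ℕ) → Subset n → Set
Admissible k n R =
  ∀ (i j : Fin n) → i ∈ R → j ∈ R → ¬ (i ≡ j) →
    ¬ IsPowerMod k n ((+ toℕ i) ℤ.- (+ toℕ j))

IsRk : ℕ → ℕ → ℕ → Set
IsRk k n v =
  (Σ (Subset n) λ R → Admissible k n R × ∣ R ∣ ≡ v) ×
  (∀ (R : Subset n) → Admissible k n R → ∣ R ∣ ≤ v)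

SquareFree : ℕ → Set
SquareFree m = ∀ (d : ℕ) → (d * d) ∣ m → d ≡ 1

-- Lower bound: if R is admissible mod m, so is the set of residues mod m^k reducing into R,
-- which has m^(k-1) |R| elements. Two of them with different reductions are already separated
-- mod m; two with the same reduction differ by a multiple of m, and if that difference were
-- x^k mod m^k then m ∣ x^k, so m ∣ x by square-freeness and m^k ∣ x^k, making them equal.
-- Upper bound: cut {0, …, p^k - 1} into the p^(k-1) blocks {p t + r : r < p}. Within a block
-- differences are differences of offsets, nonzero mod p; by Hensel's lemma (p ∤ k) a nonzero
-- k-th power residue mod p stays one mod p^k. So an admissible set mod p^k meets every block
-- in an admissible set mod p, of size at most r_k(p).

module Submission where

open import Defs

module NatDivisibility where

  open import Data.Nat
  open import Data.Nat.Properties using (*-identityˡ; *-identityʳ; *-assoc)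
  open import Data.Nat.Divisibility
  open import Data.Nat.DivMod using (_/_; m/n*n≡m)
  open import Data.Nat.GCD using (gcd; gcd[m,n]∣m; gcd[m,n]∣n; gcd[m,n]≢0)
  open import Data.Nat.Coprimality using (Coprime; coprime-divisor; coprime-/gcd; gcd≡1⇒coprime)
  open import Data.Nat.Primality using (Prime; prime⇒irreducible; prime⇒nonZero; euclidsLemma; ¬prime[1])
  open import Data.Product using (_,_)
  open import Data.Sum using (inj₁; inj₂)
  open import Relation.Binary.PropositionalEquality
  open import Relation.Nullary using (¬_; contradiction)

  ^-pres-∣ : ∀ {m n} k → m ∣ n → m ^ k ∣ n ^ k
  ^-pres-∣ zero    _   = ∣-refl
  ^-pres-∣ (suc k) m∣n = *-pres-∣ m∣n (^-pres-∣ k m∣n)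

  coprime-* : ∀ {m n o} → Coprime m n → Coprime m o → Coprime m (n * o)
  coprime-* {m} {n} m⊥n m⊥o (d∣m , d∣no) = m⊥o (d∣m , coprime-divisor d⊥n d∣no)
    where
    d⊥n : Coprime _ n
    d⊥n (e∣d , e∣n) = m⊥n (∣-trans e∣d d∣m , e∣n)

  coprime-divisor-^ : ∀ {m n o} k → Coprime m n → m ∣ n ^ k * o → m ∣ o
  coprime-divisor-^ {m} {o = o} zero    _   m∣o = subst (m ∣_) (*-identityˡ o) m∣o
  coprime-divisor-^ {m} {n} {o} (suc k) m⊥n m∣ =
    coprime-divisor-^ k m⊥n (coprime-divisor m⊥n (subst (m ∣_) (*-assoc n (n ^ k) o) m∣))

  squarefree⇒nonZero : ∀ {m} → SquareFree m → NonZero m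
  squarefree⇒nonZero {zero}  sf = contradiction (sf 0 (0 ∣0)) λ ()
  squarefree⇒nonZero {suc m} _  = _

  -- With g = gcd m x, the cofactor m / g is coprime to x / g, and to g because m is square-free;
  -- so it is coprime to x, and dividing a power of x it must be 1.
  squarefree∧∣^⇒∣ : ∀ {m x} k → SquareFree m → m ∣ x ^ k → m ∣ x
  squarefree∧∣^⇒∣ {m} {x} k sf m∣x^k = subst (_∣ x) g≡m (gcd[m,n]∣n m x)
    where
    g = gcd m x
    instance
      g≢0 : NonZero g
      g≢0 = ≢-nonZero (gcd[m,n]≢0 m x (inj₁ (≢-nonZero⁻¹ m {{squarefree⇒nonZero sf}})))
    h = m / g
    h*g≡m : h * g ≡ m
    h*g≡m = m/n*n≡m (gcd[m,n]∣m m x)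
    h⊥g : Coprime h g
    h⊥g = gcd≡1⇒coprime (sf (gcd h g)
      (subst (gcd h g * gcd h g ∣_) h*g≡m (*-pres-∣ (gcd[m,n]∣m h g) (gcd[m,n]∣n h g))))
    h⊥x : Coprime h x
    h⊥x = subst (Coprime h) (m/n*n≡m (gcd[m,n]∣n m x)) (coprime-* (coprime-/gcd m x) h⊥g)
    h≡1 : h ≡ 1
    h≡1 = ∣1⇒≡1 (coprime-divisor-^ k h⊥x
      (subst (h ∣_) (sym (*-identityʳ (x ^ k))) (∣-trans (subst (h ∣_) h*g≡m (m∣m*n g)) m∣x^k)))
    g≡m : g ≡ m
    g≡m = begin
      g      ≡⟨ *-identityˡ g ⟨
      1 * g  ≡⟨ cong (_* g) h≡1 ⟨
      h * g  ≡⟨ h*g≡m ⟩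
      m      ∎
      where open ≡-Reasoning

  prime⇒squarefree : ∀ {p} → Prime p → SquareFree p
  prime⇒squarefree {p} p-prime d d*d∣p with prime⇒irreducible p-prime (m*n∣⇒m∣ d d d*d∣p)
  ... | inj₁ d≡1 = d≡1
  ... | inj₂ refl = contradiction (subst Prime p≡1 p-prime) ¬prime[1]
    where
    instance _ = prime⇒nonZero p-prime
    p≡1 : p ≡ 1
    p≡1 = ∣1⇒≡1 (*-cancelˡ-∣ p (subst (p * p ∣_) (sym (*-identityʳ p)) d*d∣p))

  prime∤⇒coprime : ∀ {p n} → Prime p → ¬ p ∣ n → Coprime p n
  prime∤⇒coprime p-prime p∤n (d∣p , d∣n) with prime⇒irreducible p-prime d∣p
  ... | inj₁ d≡1 = d≡1
  ... | inj₂ refl = contradiction d∣n p∤n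

  prime∣^⇒∣ : ∀ {p n} k → Prime p → p ∣ n ^ k → p ∣ n
  prime∣^⇒∣ zero    p-prime p∣1 = contradiction (subst Prime (∣1⇒≡1 p∣1) p-prime) ¬prime[1]
  prime∣^⇒∣ {n = n} (suc k) p-prime p∣n^k with euclidsLemma n (n ^ k) p-prime p∣n^k
  ... | inj₁ p∣n   = p∣n
  ... | inj₂ p∣n^k = prime∣^⇒∣ k p-prime p∣n^k

module IntegerCongruences where

  import Data.Nat as ℕ
  import Data.Nat.Properties as ℕ
  import Data.Nat.Divisibility as ℕ
  open import Data.Nat.Coprimality using (Coprime; coprime-Bézout)
  open import Data.Nat.GCD using (module Bézout)
  open import Data.Nat.Primality using (Prime; euclidsLemma)
  open import Data.Nat.Base using (zero; suc)
  open import Data.Integer hiding (suc)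
  open import Data.Integer.Properties
  open import Data.Integer.Divisibility.Signed
  open import Data.Integer.Tactic.RingSolver using (solve-∀)
  open import Data.Product using (∃; _×_; _,_; proj₁; proj₂)
  open import Data.Sum using (inj₁; inj₂)
  open import Relation.Binary.PropositionalEquality
  open import Relation.Nullary using (¬_; contradiction)
  open NatDivisibility using (prime∤⇒coprime; prime∣^⇒∣)

  pos-^ : ∀ n k → + (n ℕ.^ k) ≡ (+ n) ^ k
  pos-^ n zero    = refl
  pos-^ n (suc k) = trans (pos-* n (n ℕ.^ k)) (cong (+ n *_) (pos-^ n k))

  abs-^ : ∀ x k → ∣ x ^ k ∣ ≡ ∣ x ∣ ℕ.^ k
  abs-^ x zero    = refl
  abs-^ x (suc k) = trans (abs-* x (x ^ k)) (cong (∣ x ∣ ℕ.*_) (abs-^ x k))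

  ∣m∣m-n⇒∣n : ∀ {i m n} → i ∣ m → i ∣ m - n → i ∣ n
  ∣m∣m-n⇒∣n {i} {m} {n} i∣m i∣m-n = subst (i ∣_) (m-[m-n]≡n m n) (∣m∣n⇒∣m-n i∣m i∣m-n)
    where
    m-[m-n]≡n : ∀ m n → m - (m - n) ≡ n
    m-[m-n]≡n = solve-∀

  ∣m-n∣n⇒∣m : ∀ {i m n} → i ∣ m - n → i ∣ n → i ∣ m
  ∣m-n∣n⇒∣m {i} {m} {n} i∣m-n i∣n = subst (i ∣_) (m-n+n≡m m n) (∣m∣n⇒∣m+n i∣m-n i∣n)
    where
    m-n+n≡m : ∀ m n → m - n + n ≡ m
    m-n+n≡m = solve-∀

  ≡-mod-<⇒≡ : ∀ {n a b} → a ℕ.< n → b ℕ.< n → (+ a) ≡ (+ b) [mod n ] → a ≡ b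
  ≡-mod-<⇒≡ {n} {a} {b} a<n b<n n∣a-b with ∣ + a - + b ∣ in eq
  ... | zero  = +-injective (i-j≡0⇒i≡j (+ a) (+ b) (∣i∣≡0⇒i≡0 eq))
  ... | suc d = contradiction n∣a-b (ℕ.>⇒∤ (begin-strict
      suc d           ≡⟨ eq ⟨
      ∣ + a - + b ∣   ≡⟨ cong ∣_∣ (m-n≡m⊖n a b) ⟩
      ∣ a ⊖ b ∣       ≤⟨ ∣m⊝n∣≤m⊔n a b ⟩
      a ℕ.⊔ b         <⟨ ℕ.⊔-lub a<n b<n ⟩
      n               ∎))
    where open ℕ.≤-Reasoning

  ≡-mod-trans : ∀ {n a b c} → a ≡ b [mod n ] → b ≡ c [mod n ] → a ≡ c [mod n ]
  ≡-mod-trans {n} {a} {b} {c} a≡b b≡c =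
    ∣⇒∣ᵤ (subst (+ n ∣_) (+-minus-telescope a b c)
      (∣m∣n⇒∣m+n (∣ᵤ⇒∣ {i = a - b} a≡b) (∣ᵤ⇒∣ {i = b - c} b≡c)))

  ≡-mod-sym : ∀ {n a b} → a ≡ b [mod n ] → b ≡ a [mod n ]
  ≡-mod-sym {n} {a} {b} = subst (n ℕ.∣_) (∣i-j∣≡∣j-i∣ a b)

  IsPowerMod-resp : ∀ {k n d d′} → d ≡ d′ [mod n ] → IsPowerMod k n d → IsPowerMod k n d′
  IsPowerMod-resp {d = d} {d′} d≡d′ (x , d≡x^k) =
    x , ≡-mod-trans {a = d′} (≡-mod-sym {a = d} d≡d′) d≡x^k

  IsPowerMod-∣ : ∀ {k m n d} → m ℕ.∣ n → IsPowerMod k n d → IsPowerMod k m d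
  IsPowerMod-∣ m∣n (x , d≡x^k) = x , ℕ.∣-trans m∣n d≡x^k

  pos-bézout : ∀ a b c d → 1 ℕ.+ a ℕ.* b ≡ c ℕ.* d → 1ℤ + + a * + b ≡ + c * + d
  pos-bézout a b c d eq = begin
    1ℤ + + a * + b     ≡⟨ cong (λ i → 1ℤ + i) (pos-* a b) ⟨
    + (1 ℕ.+ a ℕ.* b)  ≡⟨ cong +_ eq ⟩
    + (c ℕ.* d)        ≡⟨ pos-* c d ⟩
    + c * + d          ∎
    where open ≡-Reasoning

  coprime⇒pos-inverse-mod : ∀ {m n} → Coprime m n → ∃ λ u → + m ∣ u * + n - 1ℤ
  coprime⇒pos-inverse-mod {m} {n} m⊥n with coprime-Bézout m⊥n
  ... | Bézout.+- x y 1+yn≡xm = - + y , divides (- + x) (begin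
        - + y * + n - 1ℤ      ≡⟨ rearrange (+ y) (+ n) ⟩
        - (1ℤ + + y * + n)    ≡⟨ cong -_ (pos-bézout y n x m 1+yn≡xm) ⟩
        - (+ x * + m)         ≡⟨ neg-distribˡ-* (+ x) (+ m) ⟩
        - + x * + m           ∎)
    where
    rearrange : ∀ a b → - a * b - 1ℤ ≡ - (1ℤ + a * b)
    rearrange = solve-∀
    open ≡-Reasoning
  ... | Bézout.-+ x y 1+xm≡yn = + y , divides (+ x) (begin
        + y * + n - 1ℤ          ≡⟨ cong (_- 1ℤ) (pos-bézout x m y n 1+xm≡yn) ⟨
        1ℤ + + x * + m - 1ℤ    ≡⟨ cancel (+ x * + m) ⟩
        + x * + m              ∎)
    where
    cancel : ∀ a → 1ℤ + a - 1ℤ ≡ a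
    cancel = solve-∀
    open ≡-Reasoning

  coprime⇒inverse-mod : ∀ {m w} → Coprime m ∣ w ∣ → ∃ λ u → + m ∣ u * w - 1ℤ
  coprime⇒inverse-mod {m} {w} m⊥w with coprime⇒pos-inverse-mod m⊥w | +∣i∣≡i⊎+∣i∣≡-i w
  ... | u , inverse | inj₁ ∣w∣≡w  = u , subst (λ v → + m ∣ u * v - 1ℤ) ∣w∣≡w inverse
  ... | u , inverse | inj₂ ∣w∣≡-w = - u , subst (λ v → + m ∣ v - 1ℤ) u*∣w∣≡-u*w inverse
    where
    u*∣w∣≡-u*w : u * + ∣ w ∣ ≡ - u * w
    u*∣w∣≡-u*w = trans (cong (u *_) ∣w∣≡-w) (trans (sym (neg-distribʳ-* u w)) (neg-distribˡ-* u w))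

  binomial : ∀ a b k → ∃ λ Q → (a + b) ^ suc k ≡ a ^ suc k + + suc k * a ^ k * b + Q * (b * b)
  binomial a b zero    = 0ℤ , base a b
    where
    base : ∀ a b → (a + b) * 1ℤ ≡ a * 1ℤ + 1ℤ * 1ℤ * b + 0ℤ * (b * b)
    base = solve-∀
  binomial a b (suc k) with binomial a b k
  ... | Q , expand = a * Q + + suc k * a ^ k + b * Q , (begin
      (a + b) * (a + b) ^ suc k                                  ≡⟨ cong ((a + b) *_) expand ⟩
      (a + b) * (a * a ^ k + + suc k * a ^ k * b + Q * (b * b))  ≡⟨ step a b (+ suc k) (a ^ k) Q ⟩
      a * (a * a ^ k) + (1ℤ + + suc k) * (a * a ^ k) * b
        + (a * Q + + suc k * a ^ k + b * Q) * (b * b)            ∎)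
    where
    step : ∀ a b K A Q → (a + b) * (a * A + K * A * b + Q * (b * b))
                         ≡ a * (a * A) + (1ℤ + K) * (a * A) * b + (a * Q + K * A + b * Q) * (b * b)
    step = solve-∀
    open ≡-Reasoning

  prime∤⇒inverse-mod : ∀ {p w} → Prime p → ¬ p ℕ.∣ ∣ w ∣ → ∃ λ u → + p ∣ u * w - 1ℤ
  prime∤⇒inverse-mod p-prime p∤w = coprime⇒inverse-mod (prime∤⇒coprime p-prime p∤w)

  prime∤n*y^k : ∀ {p n y} k → Prime p → ¬ p ℕ.∣ n → ¬ p ℕ.∣ ∣ y ∣ → ¬ p ℕ.∣ ∣ + n * y ^ k ∣
  prime∤n*y^k {p} {n} {y} k p-prime p∤n p∤y p∣n*y^k
    with euclidsLemma n ∣ y ^ k ∣ p-prime (subst (p ℕ.∣_) (abs-* (+ n) (y ^ k)) p∣n*y^k)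
  ... | inj₁ p∣n   = p∤n p∣n
  ... | inj₂ p∣y^k = p∤y (prime∣^⇒∣ k p-prime (subst (p ℕ.∣_) (abs-^ y k) p∣y^k))

  -- Newton's step y′ = y + u (δ - y ^ suc k), u an inverse mod p of the derivative (suc k) y ^ k.
  hensel-step : ∀ {p n y δ u} k → p ∣ n → p ∣ u * ((+ suc k) * y ^ k) - 1ℤ → n ∣ δ - y ^ suc k →
                ∃ λ y′ → (n ∣ y′ - y) × (p * n ∣ δ - y′ ^ suc k)
  hensel-step {p} {_} {y} {δ} {u} k (divides a refl) (divides e inverse) (divides c root) =
    y′ , divides (u * c) (shift y (u * c) n) ,
    divides (- (c * e) - Q * (u * c) * (u * c) * a) (begin
      δ - y′ ^ suc k
        ≡⟨ cong (λ z → δ - z) expand ⟩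
      δ - (y ^ suc k + W * (u * c * n) + Q * (u * c * n * (u * c * n)))
        ≡⟨ regroup δ (y ^ suc k) W u c n Q ⟩
      (δ - y ^ suc k) - c * n - c * n * (u * W - 1ℤ) - Q * (u * c * n * (u * c * n))
        ≡⟨ cong₂ (λ r i → r - c * n - c * n * i - Q * (u * c * n * (u * c * n))) root inverse ⟩
      c * n - c * n - c * n * (e * p) - Q * (u * c * n * (u * c * n))
        ≡⟨ collect c a p e u Q ⟩
      (- (c * e) - Q * (u * c) * (u * c) * a) * (p * n) ∎)
    where
    n = a * p
    W = (+ suc k) * y ^ k
    y′ = y + u * c * n
    Q = proj₁ (binomial y (u * c * n) k)
    expand = proj₂ (binomial y (u * c * n) k)
    shift : ∀ y t n → y + t * n - y ≡ t * n
    shift = solve-∀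
    regroup : ∀ δ Y W u c n Q → δ - (Y + W * (u * c * n) + Q * (u * c * n * (u * c * n)))
                                ≡ (δ - Y) - c * n - c * n * (u * W - 1ℤ) - Q * (u * c * n * (u * c * n))
    regroup = solve-∀
    collect : ∀ c a p e u Q →
      c * (a * p) - c * (a * p) - c * (a * p) * (e * p) - Q * (u * c * (a * p) * (u * c * (a * p)))
        ≡ (- (c * e) - Q * (u * c) * (u * c) * a) * (p * (a * p))
    collect = solve-∀
    open ≡-Reasoning

  hensel-lift : ∀ {p k x δ} → Prime p → ¬ p ℕ.∣ suc k → ¬ p ℕ.∣ ∣ x ∣ → + p ∣ δ - x ^ suc k →
                ∀ j → ∃ λ y → (+ p ∣ y - x) × ((+ p) ^ suc j ∣ δ - y ^ suc k)
  hensel-lift {p} {k} {x} {δ} _ _ _ root zero =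
    x , divides 0ℤ (x-x≡0*p x (+ p)) , subst (_∣ δ - x ^ suc k) (sym (*-identityʳ (+ p))) root
    where
    x-x≡0*p : ∀ x p → x - x ≡ 0ℤ * p
    x-x≡0*p = solve-∀
  hensel-lift {p} {k} {x} {δ} p-prime p∤k p∤x root (suc j)
    with y , p∣y-x , root′ ← hensel-lift {p} {k} {x} {δ} p-prime p∤k p∤x root j
    with u , inverse ← prime∤⇒inverse-mod {w = (+ suc k) * y ^ k} p-prime
           (prime∤n*y^k k p-prime p∤k λ p∣y → p∤x (∣⇒∣ᵤ (∣m∣m-n⇒∣n (∣ᵤ⇒∣ {+ p} {y} p∣y) p∣y-x)))
    with y′ , p^sj∣y′-y , root″ ←
           hensel-step {y = y} {δ} {u} k (∣m⇒∣m*n ((+ p) ^ j) ∣-refl) inverse root′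
    = y′ , subst (+ p ∣_) (+-minus-telescope y′ y x) (∣m∣n⇒∣m+n p∣y′-y p∣y-x) , root″
    where
    p∣y′-y : + p ∣ y′ - y
    p∣y′-y = ∣-trans (∣m⇒∣m*n ((+ p) ^ j) ∣-refl) p^sj∣y′-y

  hensel : ∀ {p k d} → Prime p → ¬ p ℕ.∣ k → ¬ p ℕ.∣ ∣ d ∣ →
           IsPowerMod k p d → ∀ j → IsPowerMod k (p ℕ.^ j) d
  hensel {p} {zero} _ p∤0 _ _ _ = contradiction (p ℕ.∣0) p∤0
  hensel _ _ _ (x , _) zero = x , ℕ.1∣ _
  hensel {p} {suc k} {d} p-prime p∤k p∤d (x , d≡x^k) (suc j)
    with hensel-lift {x = x} {d} p-prime p∤k p∤x (∣ᵤ⇒∣ {+ p} {d - x ^ suc k} d≡x^k) j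
    where
    p∤x : ¬ p ℕ.∣ ∣ x ∣
    p∤x p∣x = p∤d (∣⇒∣ᵤ (∣m-n∣n⇒∣m {m = d} (∣ᵤ⇒∣ {+ p} {d - x ^ suc k} d≡x^k)
                                            (∣m⇒∣m*n (x ^ k) (∣ᵤ⇒∣ {+ p} {x} p∣x))))
  ... | y , _ , root = y , ∣⇒∣ᵤ (subst (_∣ d - y ^ suc k) (sym (pos-^ p (suc j))) root)

module SubsetBlocks where

  open import Data.Nat
  open import Data.Nat.Properties using (+-mono-≤)
  open import Data.Bool using (true; false)
  open import Data.Fin using (zero; suc; combine)
  open import Data.Fin.Subset using (Subset; _∈_; ∣_∣)
  open import Data.Vec using (Vec; []; _∷_; _++_; concat; replicate; lookup)
  open import Data.Vec.Properties using (lookup-concat; []=⇒lookup; lookup⇒[]=)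
  open import Function using (_∘_)
  open import Relation.Binary.PropositionalEquality

  ∣p++q∣≡∣p∣+∣q∣ : ∀ {m n} (p : Subset m) (q : Subset n) → ∣ p ++ q ∣ ≡ ∣ p ∣ + ∣ q ∣
  ∣p++q∣≡∣p∣+∣q∣ []          q = refl
  ∣p++q∣≡∣p∣+∣q∣ (true ∷ p)  q = cong suc (∣p++q∣≡∣p∣+∣q∣ p q)
  ∣p++q∣≡∣p∣+∣q∣ (false ∷ p) q = ∣p++q∣≡∣p∣+∣q∣ p q

  ∣concat-replicate∣ : ∀ {m} M (p : Subset m) → ∣ concat (replicate M p) ∣ ≡ M * ∣ p ∣
  ∣concat-replicate∣ zero    p = refl
  ∣concat-replicate∣ (suc M) p =
    trans (∣p++q∣≡∣p∣+∣q∣ p _) (cong (∣ p ∣ +_) (∣concat-replicate∣ M p))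

  ∣concat∣≤ : ∀ {m M b} (ps : Vec (Subset m) M) → (∀ t → ∣ lookup ps t ∣ ≤ b) → ∣ concat ps ∣ ≤ M * b
  ∣concat∣≤ []       _ = z≤n
  ∣concat∣≤ (p ∷ ps) bounded = subst (_≤ _) (sym (∣p++q∣≡∣p∣+∣q∣ p (concat ps)))
    (+-mono-≤ (bounded zero) (∣concat∣≤ ps (bounded ∘ suc)))

  ∈-concat⁺ : ∀ {m M} (ps : Vec (Subset m) M) t r → r ∈ lookup ps t → combine t r ∈ concat ps
  ∈-concat⁺ ps t r r∈ =
    lookup⇒[]= (combine t r) (concat ps) (trans (lookup-concat ps t r) ([]=⇒lookup r∈))

  ∈-concat⁻ : ∀ {m M} (ps : Vec (Subset m) M) t r → combine t r ∈ concat ps → r ∈ lookup ps t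
  ∈-concat⁻ ps t r tr∈ =
    lookup⇒[]= r (lookup ps t) (trans (sym (lookup-concat ps t r)) ([]=⇒lookup tr∈))

module Admissibility where

  import Data.Nat as ℕ
  import Data.Nat.Divisibility as ℕ
  open import Data.Fin using (Fin; toℕ; combine)
  open import Data.Fin.Properties using (_≟_)
  open import Data.Fin.Properties
    using (toℕ-combine; combine-surjective; combine-injectiveʳ; toℕ-injective; toℕ<n; nonZeroIndex)
  open import Data.Fin.Subset using (Subset; _∈_)
  open import Data.Vec using (Vec; concat; replicate; lookup)
  open import Data.Vec.Properties using (lookup-replicate)
  open import Data.Integer hiding (_≟_)
  open import Data.Integer.Properties using (pos-*; +-inverseʳ; +-identityʳ; +-identityˡ; *-zeroʳ; *-comm)
  open import Data.Integer.Divisibility.Signed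
  open import Data.Integer.Tactic.RingSolver using (solve-∀)
  open import Data.Product using (_,_)
  open import Relation.Binary.PropositionalEquality
  open import Function using (_∘′_)
  open import Relation.Nullary using (¬_; yes; no)
  open IntegerCongruences
  open SubsetBlocks using (∈-concat⁺; ∈-concat⁻)

  toℤ-combine : ∀ {M m} (t : Fin M) (r : Fin m) → + toℕ (combine t r) ≡ + m * + toℕ t + + toℕ r
  toℤ-combine {m = m} t r = trans (cong +_ (toℕ-combine t r)) (cong (_+ + toℕ r) (pos-* m (toℕ t)))

  combine-diff : ∀ {M m} (t t′ : Fin M) (r r′ : Fin m) →
    + toℕ (combine t r) - + toℕ (combine t′ r′) ≡ + m * (+ toℕ t - + toℕ t′) + (+ toℕ r - + toℕ r′)
  combine-diff {m = m} t t′ r r′ = trans (cong₂ _-_ (toℤ-combine t r) (toℤ-combine t′ r′))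
    (distribute (+ m) (+ toℕ t) (+ toℕ t′) (+ toℕ r) (+ toℕ r′))
    where
    distribute : ∀ m a a′ b b′ → (m * a + b) - (m * a′ + b′) ≡ m * (a - a′) + (b - b′)
    distribute = solve-∀

  same-residue⇒same-block : ∀ {k m M} → (∀ x → m ℕ.∣ x ℕ.^ k → M ℕ.* m ℕ.∣ x ℕ.^ k) →
    (t t′ : Fin M) (r : Fin m) →
    IsPowerMod k (M ℕ.* m) (+ toℕ (combine t r) - + toℕ (combine t′ r)) → t ≡ t′
  same-residue⇒same-block {k} {m} {M} lift t t′ r (x , D≡x^k) =
    toℕ-injective (≡-mod-<⇒≡ (toℕ<n t) (toℕ<n t′) (∣⇒∣ᵤ M∣T-T′))
    where
    instance _ = nonZeroIndex r
    T-T′ = + toℕ t - + toℕ t′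
    D = + toℕ (combine t r) - + toℕ (combine t′ r)
    D≡T-T′*m : D ≡ T-T′ * + m
    D≡T-T′*m = begin
      D                                          ≡⟨ combine-diff t t′ r r ⟩
      + m * T-T′ + (+ toℕ r - + toℕ r)           ≡⟨ cong (λ z → + m * T-T′ + z) (+-inverseʳ (+ toℕ r)) ⟩
      + m * T-T′ + 0ℤ                            ≡⟨ +-identityʳ _ ⟩
      + m * T-T′                                 ≡⟨ *-comm (+ m) T-T′ ⟩
      T-T′ * + m                                 ∎
      where open ≡-Reasoning
    Mm∣D-x^k : + (M ℕ.* m) ∣ D - x ^ k
    Mm∣D-x^k = ∣ᵤ⇒∣ {+ (M ℕ.* m)} {D - x ^ k} D≡x^k
    m∣x^k : + m ∣ x ^ k
    m∣x^k = ∣m∣m-n⇒∣n (subst (+ m ∣_) (sym D≡T-T′*m) (∣n⇒∣m*n T-T′ ∣-refl))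
                       (∣-trans (∣ᵤ⇒∣ (ℕ.n∣m*n M)) Mm∣D-x^k)
    Mm∣x^k : + (M ℕ.* m) ∣ x ^ k
    Mm∣x^k = ∣ᵤ⇒∣ (subst (M ℕ.* m ℕ.∣_) (sym (abs-^ x k))
                    (lift ∣ x ∣ (subst (m ℕ.∣_) (abs-^ x k) (∣⇒∣ᵤ m∣x^k))))
    M∣T-T′ : + M ∣ T-T′
    M∣T-T′ = *-cancelʳ-∣ (+ m) (subst₂ _∣_ (pos-* M m) D≡T-T′*m (∣m-n∣n⇒∣m Mm∣D-x^k Mm∣x^k))

  combine-≡-mod : ∀ {M m} (t t′ : Fin M) (r r′ : Fin m) →
    (+ toℕ (combine t r) - + toℕ (combine t′ r′)) ≡ (+ toℕ r - + toℕ r′) [mod m ]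
  combine-≡-mod {m = m} t t′ r r′ = ∣⇒∣ᵤ (divides (+ toℕ t - + toℕ t′)
    (trans (cong (_- (+ toℕ r - + toℕ r′)) (combine-diff t t′ r r′)) (cancel (+ m) _ _)))
    where
    cancel : ∀ m a b → m * a + b - b ≡ a * m
    cancel = solve-∀

  replicate-admissible : ∀ {k m M} {R : Subset m} → (∀ x → m ℕ.∣ x ℕ.^ k → M ℕ.* m ℕ.∣ x ℕ.^ k) →
    Admissible k m R → Admissible k (M ℕ.* m) (concat (replicate M R))
  replicate-admissible {k} {m} {M} {R} lift admissible i j i∈ j∈ i≢j power
    with combine-surjective {M} {m} i | combine-surjective {M} {m} j
  ... | t , r , refl | t′ , r′ , refl with r ≟ r′
  ...   | yes refl = i≢j (cong (λ s → combine s r) (same-residue⇒same-block {k} lift t t′ r power))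
  ...   | no r≢r′  = admissible r r′ (∈R t r i∈) (∈R t′ r′ j∈) r≢r′
          (IsPowerMod-resp {k} {m} {D} (combine-≡-mod t t′ r r′)
            (IsPowerMod-∣ {k} {d = D} (ℕ.n∣m*n M) power))
    where
    D = + toℕ (combine t r) - + toℕ (combine t′ r′)
    ∈R : ∀ t r → combine t r ∈ concat (replicate M R) → r ∈ R
    ∈R t r tr∈ = subst (r ∈_) (lookup-replicate t R) (∈-concat⁻ (replicate M R) t r tr∈)

  block-admissible : ∀ {k m M} → (∀ d → ¬ m ℕ.∣ ∣ d ∣ → IsPowerMod k m d → IsPowerMod k (M ℕ.* m) d) →
    (ps : Vec (Subset m) M) → Admissible k (M ℕ.* m) (concat ps) → ∀ t → Admissible k m (lookup ps t)
  block-admissible {k} {m} {M} lift ps admissible t r r′ r∈ r′∈ r≢r′ power =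
    admissible (combine t r) (combine t r′) (∈-concat⁺ ps t r r∈) (∈-concat⁺ ps t r′ r′∈)
      (r≢r′ ∘′ combine-injectiveʳ t r t r′)
      (subst (IsPowerMod k (M ℕ.* m)) (sym same-block-diff) (lift (+ toℕ r - + toℕ r′) m∤d power))
    where
    m∤d : ¬ m ℕ.∣ ∣ + toℕ r - + toℕ r′ ∣
    m∤d = r≢r′ ∘′ toℕ-injective ∘′ ≡-mod-<⇒≡ (toℕ<n r) (toℕ<n r′)
    same-block-diff : + toℕ (combine t r) - + toℕ (combine t r′) ≡ + toℕ r - + toℕ r′
    same-block-diff = begin
      + toℕ (combine t r) - + toℕ (combine t r′)   ≡⟨ combine-diff t t r r′ ⟩
      + m * (+ toℕ t - + toℕ t) + d                ≡⟨ cong (λ z → + m * z + d) (+-inverseʳ (+ toℕ t)) ⟩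
      + m * 0ℤ + d                                 ≡⟨ cong (_+ d) (*-zeroʳ (+ m)) ⟩
      0ℤ + d                                       ≡⟨ +-identityˡ d ⟩
      d                                            ∎
      where
      d = + toℕ r - + toℕ r′
      open ≡-Reasoning

open import Data.Nat using (ℕ; zero; suc; _≤_; _*_; _^_; _∸_)
open import Data.Nat.Properties using (*-comm; ≤-antisym)
open import Data.Nat.Divisibility using (_∣_)
open import Data.Nat.Primality using (Prime)
import Data.Integer as ℤ
open import Data.Fin.Subset using (∣_∣)
open import Data.Vec using (group)
open import Data.Product using (_×_; _,_; proj₂)
open import Function using (_∘_)
open import Relation.Binary.PropositionalEquality using (_≡_; refl; subst)
open import Relation.Nullary using (¬_)
open NatDivisibility using (^-pres-∣; squarefree∧∣^⇒∣; prime⇒squarefree)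
open IntegerCongruences using (hensel)
open SubsetBlocks using (∣concat-replicate∣; ∣concat∣≤)
open Admissibility using (replicate-admissible; block-admissible)

rk-lower-bound : ∀ {k m M a b} → (∀ x → m ∣ x ^ k → m * M ∣ x ^ k) →
  IsRk k (m * M) a → IsRk k m b → M * b ≤ a
rk-lower-bound {k} {m} {M} {a} lift rk-mM ((R , admissible , refl) , _) =
  subst (_≤ a) (∣concat-replicate∣ M R)
    (maximal _ (replicate-admissible {k} {M = M} lift′ admissible))
  where
  maximal : ∀ S → Admissible k (M * m) S → ∣ S ∣ ≤ a
  maximal = proj₂ (subst (λ N → IsRk k N a) (*-comm m M) rk-mM)
  lift′ : ∀ x → m ∣ x ^ k → M * m ∣ x ^ k
  lift′ x = subst (_∣ x ^ k) (*-comm m M) ∘ lift x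

rk-upper-bound : ∀ {k m M a b} → (∀ d → ¬ m ∣ ℤ.∣ d ∣ → IsPowerMod k m d → IsPowerMod k (m * M) d) →
  IsRk k (m * M) a → IsRk k m b → a ≤ M * b
rk-upper-bound {k} {m} {M} {a} lift rk-mM (_ , maximal)
  with subst (λ N → IsRk k N a) (*-comm m M) rk-mM
... | (S , admissible , refl) , _ with group M m S
... | ps , refl = ∣concat∣≤ ps (λ t → maximal _ (block-admissible {k} lift′ ps admissible t))
  where
  lift′ : ∀ d → ¬ m ∣ ℤ.∣ d ∣ → IsPowerMod k m d → IsPowerMod k (M * m) d
  lift′ d m∤d = subst (λ N → IsPowerMod k N d) (*-comm m M) ∘ lift d m∤d

squarefree⇒rk-lower-bound : ∀ {m a b} k → SquareFree m →
  IsRk (suc k) (m ^ suc k) a → IsRk (suc k) m b → m ^ k * b ≤ a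
squarefree⇒rk-lower-bound {m} k squarefree =
  rk-lower-bound {suc k} {m}
    (λ x m∣x^k → ^-pres-∣ (suc k) (squarefree∧∣^⇒∣ {x = x} (suc k) squarefree m∣x^k))

prime⇒rk-upper-bound : ∀ {p a b} k → Prime p → ¬ p ∣ suc k →
  IsRk (suc k) (p ^ suc k) a → IsRk (suc k) p b → a ≤ p ^ k * b
prime⇒rk-upper-bound {p} k p-prime p∤k =
  rk-upper-bound {suc k} {p}
    (λ d p∤d power → hensel {p} {suc k} {d} p-prime p∤k p∤d power (suc k))

proposition5p1 : (∀ (m k a b : ℕ) → 1 ≤ m → 2 ≤ k → SquareFree m →
    IsRk k (m ^ k) a → IsRk k m b → m ^ (k ∸ 1) * b ≤ a)
    × (∀ (p k a b : ℕ) → Prime p → 2 ≤ k → ¬ (p ∣ k) →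
    IsRk k (p ^ k) a → IsRk k p b → a ≡ p ^ (k ∸ 1) * b)
proposition5p1 = lower-bound , exact-value
  where
  -- 1 ≤ m is unused: square-freeness already excludes m = 0.
  lower-bound : ∀ (m k a b : ℕ) → 1 ≤ m → 2 ≤ k → SquareFree m →
    IsRk k (m ^ k) a → IsRk k m b → m ^ (k ∸ 1) * b ≤ a
  lower-bound m zero    a b _ ()
  lower-bound m (suc k) a b _ _ squarefree = squarefree⇒rk-lower-bound k squarefree

  exact-value : ∀ (p k a b : ℕ) → Prime p → 2 ≤ k → ¬ (p ∣ k) →
    IsRk k (p ^ k) a → IsRk k p b → a ≡ p ^ (k ∸ 1) * b
  exact-value p zero    a b _       ()
  exact-value p (suc k) a b p-prime _ p∤k rk-p^k rk-p =
    ≤-antisym (prime⇒rk-upper-bound k p-prime p∤k rk-p^k rk-p)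
              (squarefree⇒rk-lower-bound k (prime⇒squarefree p-prime) rk-p^k rk-p)
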